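{- Let $W=I_2(m)$ be the finite dihedral Coxeter group with generators $S=\{s,r\}$ and relations $s^2=r^2=(sr)^m=e$ ($m\geq 2$ finite). For all $u,v\in I_2(m)$, $$T_L(u\vee_R v)=T\cap V_{I_2(m)}(u,v),$$ where $u\vee_R v$ is the join of $u$ and $v$ in the right weak order.
   Context: $\ell$ denotes Coxeter length with respect to $S$; $T=\{wsw^{ -1}\mid w\in W, s\in S\}$ is the set of reflections. Right weak order: $u\leq_R v$ iff some reduced expression of $u$ is a prefix of a reduced expression of $v$; for finite $W$ it is a lattice. Left-reflection set: $T_L(w)=\{t\in T\mid \ell(tw)<\ell(w)\}$. Bruhat graph of $W$: vertex set $W$, directed edge $x\xrightarrow{t}y$ labeled $t\in T$ iff $y=tx$ and $\ell(x)<\ell(y)$. A $(u,v)$-Bruhat path is a directed path in the Bruhat graph starting at $e$ whose edge labels all lie in $T_L(u)\cup T_L(v)$; $V_W(u,v)$ is the set of all vertices of all $(u,v)$-Bruhat paths. -}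

module Defs where

open import Data.Nat using (ℕ; zero; suc; _+_; _∸_; _<_; NonZero)
open import Data.Nat.DivMod using (_%_; m%n<n)
open import Data.Fin using (Fin; toℕ; fromℕ<)
open import Data.Bool using (Bool; true; false; _xor_; if_then_else_)
open import Data.List using (List; []; _∷_; _++_; length)
open import Data.Product using (Σ; _×_; _,_; ∃)
open import Data.Sum using (_⊎_)
open import Relation.Binary.PropositionalEquality using (_≡_)

-- The dihedral group I₂(m) (order 2m), modelled concretely as Z/m ⋊ Z/2:
-- (k , false) is the rotation ρ^k, (k , true) is ρ^k·s.
module Dihedral (m : ℕ) .{{_ : NonZero m}} where

  modm : ℕ → Fin m
  modm a = fromℕ< (m%n<n a m)

  addZ : Fin m → Fin m → Fin m
  addZ a b = modm (toℕ a + toℕ b)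

  negZ : Fin m → Fin m
  negZ a = modm (m ∸ toℕ a)

  D : Set
  D = Fin m × Bool

  _·_ : D → D → D
  (a , ε) · (b , δ) = addZ a (if ε then negZ b else b) , ε xor δ

  e : D
  e = modm 0 , false

  inv : D → D
  inv (a , false) = negZ a , false
  inv (a , true)  = a , true

  -- Coxeter generators S = {s , r}: s = (0,true), r = ρ·s = (1,true);
  -- then s² = r² = e and s·r = ρ⁻¹ has order m.
  data Gen : Set where
    gs gr : Gen

  gen : Gen → D
  gen gs = modm 0 , true
  gen gr = modm 1 , true

  Word : Set
  Word = List Gen

  eval : Word → D
  eval []       = e
  eval (g ∷ ws) = gen g · eval ws

  Len : D → ℕ → Set
  Len w n = (Σ Word λ ws → eval ws ≡ w × length ws ≡ n)
          × (∀ (ws : Word) → eval ws ≡ w → n Data.Nat.≤ length ws)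

  LenLt : D → D → Set
  LenLt x y = Σ ℕ λ a → Σ ℕ λ b → Len x a × Len y b × a < b

  Reduced : Word → D → Set
  Reduced ws w = eval ws ≡ w × Len w (length ws)

  _≤R_ : D → D → Set
  u ≤R v = Σ Word λ as → Σ Word λ bs → Reduced as u × Reduced (as ++ bs) v

  IsJoin : D → D → D → Set
  IsJoin u v j = u ≤R j × v ≤R j × (∀ z → u ≤R z → v ≤R z → j ≤R z)

  IsReflection : D → Set
  IsReflection t = Σ D λ w → Σ Gen λ g → t ≡ (w · gen g) · inv w

  TL : D → D → Set
  TL w t = IsReflection t × LenLt (t · w) w

  -- V(u,v): vertices of (u,v)-Bruhat paths, i.e. the vertices reachable from e
  -- along Bruhat-graph edges x →t t·x (t ∈ T, ℓ(x) < ℓ(t·x)) with t ∈ T_L(u) ∪ T_L(v)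
  data V (u v : D) : D → Set where
    start : V u v e
    step  : ∀ {x t} → V u v x → IsReflection t → (TL u t ⊎ TL v t)
          → LenLt x (t · x) → V u v (t · x)

-- Number the 2m elements of I₂(m) around its Cayley graph, a 2m-cycle: ρᵃ sits at position 2a
-- and ρᵃs at 2a − 1 (mod 2m). Left multiplication by a reflection at position p acts on positions
-- as z ↦ p − z, and ℓ(w) is the distance from 0 to the position of w. So if j sits at position c,
-- T_L(j) consists of the reflections strictly closer to c than 0 is: those on the open arc from 0
-- to 2c through c. A length-increasing step z ↦ p − z with p on that arc keeps z on the arc, so
-- every vertex of a Bruhat path labelled in T_L(u) ∪ T_L(v) ⊆ T_L(u ∨ v) stays there, and the
-- reflections among these vertices lie in T_L(u ∨ v). Conversely, if u and v are comparable then
-- u ∨ v is the larger one and each of its left reflections is a single Bruhat step from e;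
-- otherwise u and v have different left descents, so both simple reflections are labels and the
-- alternating words reach every element.

module Submission where

open import Data.Bool using (Bool; true; false; not; _xor_; if_then_else_)
open import Data.Bool.Properties using (xor-assoc; xor-identityʳ)
open import Data.Empty using (⊥-elim)
open import Data.Fin using (Fin; toℕ)
open import Data.Fin.Properties using (toℕ-fromℕ<; toℕ-injective; toℕ<n)
open import Data.List using ([]; _∷_; _++_; length)
open import Data.List.Properties using (length-++; ++-identityʳ)
open import Data.Nat
open import Data.Nat.DivMod
open import Data.Nat.Properties
open import Data.Nat.Tactic.RingSolver using (solve-∀)
open import Data.Product using (Σ; _×_; _,_; proj₁; proj₂)
open import Data.Sum using (_⊎_; inj₁; inj₂)
open import Relation.Binary.Bundles using (Setoid)
open import Relation.Binary.PropositionalEquality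
import Relation.Binary.Reasoning.Setoid
open import Relation.Nullary using (yes; no)

open import Defs

module Congruence (M : ℕ) .{{_ : NonZero M}} where

  infix 4 _≋_
  record _≋_ (a b : ℕ) : Set where
    constructor mkCong
    field %-≡ : a % M ≡ b % M

  ≋-refl : ∀ {a} → a ≋ a
  ≋-refl = mkCong refl

  ≋-sym : ∀ {a b} → a ≋ b → b ≋ a
  ≋-sym (mkCong p) = mkCong (sym p)

  ≋-trans : ∀ {a b c} → a ≋ b → b ≋ c → a ≋ c
  ≋-trans (mkCong p) (mkCong q) = mkCong (trans p q)

  ≋-setoid : Setoid _ _
  ≋-setoid = record
    { Carrier = ℕ
    ; _≈_ = _≋_
    ; isEquivalence = record { refl = ≋-refl ; sym = ≋-sym ; trans = ≋-trans }
    }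

  module ≋-Reasoning = Relation.Binary.Reasoning.Setoid ≋-setoid

  ≡⇒≋ : ∀ {a b} → a ≡ b → a ≋ b
  ≡⇒≋ p = mkCong (cong (_% M) p)

  m%M≋m : ∀ a → a % M ≋ a
  m%M≋m a = mkCong (m%n%n≡m%n a M)

  +-cong : ∀ {a a' b b'} → a ≋ a' → b ≋ b' → a + b ≋ a' + b'
  +-cong {a} {a'} {b} {b'} (mkCong p) (mkCong q) = mkCong (begin
    (a + b) % M               ≡⟨ %-distribˡ-+ a b M ⟩
    (a % M + b % M) % M       ≡⟨ cong₂ (λ x y → (x + y) % M) p q ⟩
    (a' % M + b' % M) % M     ≡⟨ %-distribˡ-+ a' b' M ⟨
    (a' + b') % M             ∎)
    where open ≡-Reasoning

  m+kM≋m : ∀ a k → a + k * M ≋ a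
  m+kM≋m a k = mkCong ([m+kn]%n≡m%n a k M)

  M≋0 : M ≋ 0
  M≋0 = ≋-trans (≡⇒≋ (sym (+-identityʳ M))) (m+kM≋m 0 1)

  +-cancelʳ-≋ : ∀ {a b} c → a + c ≋ b + c → a ≋ b
  +-cancelʳ-≋ {a} {b} c p = begin
    a                   ≈⟨ undo a ⟨
    a + (c + c⁻)        ≡⟨ +-assoc a c c⁻ ⟨
    a + c + c⁻          ≈⟨ +-cong p ≋-refl ⟩
    b + c + c⁻          ≡⟨ +-assoc b c c⁻ ⟩
    b + (c + c⁻)        ≈⟨ undo b ⟩
    b                   ∎
    where
    open ≋-Reasoning
    c⁻ = M ∸ c % M
    c+c⁻≋0 : c + c⁻ ≋ 0
    c+c⁻≋0 = ≋-trans (+-cong (≋-sym (m%M≋m c)) ≋-refl)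
                     (≋-trans (≡⇒≋ (m+[n∸m]≡n (m%n≤n c M))) M≋0)
    undo : ∀ x → x + (c + c⁻) ≋ x
    undo x = ≋-trans (+-cong (≋-refl {x}) c+c⁻≋0) (≡⇒≋ (+-identityʳ x))

  ≋⇒≡ : ∀ {a b} → a < M → b < M → a ≋ b → a ≡ b
  ≋⇒≡ a<M b<M (mkCong p) = trans (sym (m<n⇒m%n≡m a<M)) (trans p (m<n⇒m%n≡m b<M))

module DihedralGroup (m : ℕ) .{{_ : NonZero m}} where
  open Dihedral m
  open Congruence m

  toℕ-modm : ∀ n → toℕ (modm n) ≋ n
  toℕ-modm n = ≋-trans (≡⇒≋ (toℕ-fromℕ< _)) (m%M≋m n)

  toℕ-addZ : ∀ a b → toℕ (addZ a b) ≋ toℕ a + toℕ b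
  toℕ-addZ a b = toℕ-modm _

  toℕ-negZ : ∀ a → toℕ (negZ a) + toℕ a ≋ 0
  toℕ-negZ a = ≋-trans (+-cong (toℕ-modm (m ∸ toℕ a)) ≋-refl)
                       (≋-trans (≡⇒≋ (m∸n+n≡m (<⇒≤ (toℕ<n a)))) M≋0)

  toℕ-≋-injective : ∀ {a b} → toℕ a ≋ toℕ b → a ≡ b
  toℕ-≋-injective {a} {b} p = toℕ-injective (≋⇒≡ (toℕ<n a) (toℕ<n b) p)

  toℕ-negZ-addZ : ∀ b c → toℕ (negZ (addZ b c)) ≋ toℕ (negZ b) + toℕ (negZ c)
  toℕ-negZ-addZ b c = +-cancelʳ-≋ (toℕ b + toℕ c) (begin
    toℕ (negZ (addZ b c)) + (toℕ b + toℕ c)     ≈⟨ +-cong ≋-refl (toℕ-addZ b c) ⟨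
    toℕ (negZ (addZ b c)) + toℕ (addZ b c)      ≈⟨ toℕ-negZ (addZ b c) ⟩
    0                                           ≈⟨ +-cong (toℕ-negZ b) (toℕ-negZ c) ⟨
    (toℕ (negZ b) + toℕ b) + (toℕ (negZ c) + toℕ c)
      ≡⟨ interchange (toℕ (negZ b)) (toℕ b) (toℕ (negZ c)) (toℕ c) ⟩
    (toℕ (negZ b) + toℕ (negZ c)) + (toℕ b + toℕ c) ∎)
    where
    open ≋-Reasoning
    interchange : ∀ w x y z → (w + x) + (y + z) ≡ (w + y) + (x + z)
    interchange = solve-∀

  toℕ-negZ-involutive : ∀ c → toℕ (negZ (negZ c)) ≋ toℕ c
  toℕ-negZ-involutive c = +-cancelʳ-≋ (toℕ (negZ c))
    (≋-trans (toℕ-negZ (negZ c)) (≋-sym (≋-trans (≡⇒≋ (+-comm (toℕ c) _)) (toℕ-negZ c))))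

  signed : Bool → Fin m → Fin m
  signed ε b = if ε then negZ b else b

  toℕ-signed-addZ : ∀ ε δ b c →
    toℕ (signed ε (addZ b (signed δ c))) ≋ toℕ (signed ε b) + toℕ (signed (ε xor δ) c)
  toℕ-signed-addZ false δ     b c = toℕ-addZ b (signed δ c)
  toℕ-signed-addZ true  false b c = toℕ-negZ-addZ b c
  toℕ-signed-addZ true  true  b c = ≋-trans (toℕ-negZ-addZ b (negZ c))
                                            (+-cong ≋-refl (toℕ-negZ-involutive c))

  ·-assoc : ∀ x y z → (x · y) · z ≡ x · (y · z)
  ·-assoc (a , ε) (b , δ) (c , γ) = cong₂ _,_ (toℕ-≋-injective (begin
    toℕ (addZ (addZ a (signed ε b)) (signed (ε xor δ) c))
      ≈⟨ toℕ-addZ (addZ a (signed ε b)) _ ⟩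
    toℕ (addZ a (signed ε b)) + toℕ (signed (ε xor δ) c)
      ≈⟨ +-cong (toℕ-addZ a _) ≋-refl ⟩
    toℕ a + toℕ (signed ε b) + toℕ (signed (ε xor δ) c)
      ≡⟨ +-assoc (toℕ a) _ _ ⟩
    toℕ a + (toℕ (signed ε b) + toℕ (signed (ε xor δ) c))
      ≈⟨ +-cong ≋-refl (toℕ-signed-addZ ε δ b c) ⟨
    toℕ a + toℕ (signed ε (addZ b (signed δ c)))
      ≈⟨ toℕ-addZ a _ ⟨
    toℕ (addZ a (signed ε (addZ b (signed δ c)))) ∎)) (xor-assoc ε δ γ)
    where open ≋-Reasoning

  toℕ-signed-zero : ∀ ε → toℕ (signed ε (modm 0)) ≋ 0
  toℕ-signed-zero false = toℕ-modm 0
  toℕ-signed-zero true  = +-cancelʳ-≋ (toℕ (modm 0)) (≋-trans (toℕ-negZ (modm 0)) (≋-sym (toℕ-modm 0)))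

  ·-identityˡ : ∀ y → e · y ≡ y
  ·-identityˡ (b , δ) = cong (_, δ) (toℕ-≋-injective (≋-trans (toℕ-addZ _ b) (+-cong (toℕ-modm 0) ≋-refl)))

  ·-identityʳ : ∀ y → y · e ≡ y
  ·-identityʳ (a , ε) = cong₂ _,_
    (toℕ-≋-injective (≋-trans (toℕ-addZ a _)
                     (≋-trans (+-cong ≋-refl (toℕ-signed-zero ε)) (≡⇒≋ (+-identityʳ _)))))
    (xor-identityʳ ε)

  inv-e : inv e ≡ e
  inv-e = cong (_, false) (toℕ-≋-injective (≋-trans (toℕ-signed-zero true) (≋-sym (toℕ-modm 0))))

  reflection-involutive : ∀ a → (a , true) · (a , true) ≡ e
  reflection-involutive a = cong (_, false) (toℕ-≋-injective (begin
    toℕ (addZ a (negZ a)) ≈⟨ toℕ-addZ a (negZ a) ⟩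
    toℕ a + toℕ (negZ a)  ≡⟨ +-comm (toℕ a) _ ⟩
    toℕ (negZ a) + toℕ a  ≈⟨ toℕ-negZ a ⟩
    0                     ≈⟨ toℕ-modm 0 ⟨
    toℕ (modm 0)          ∎))
    where open ≋-Reasoning

  gen-involutive : ∀ g → gen g · gen g ≡ e
  gen-involutive gs = reflection-involutive _
  gen-involutive gr = reflection-involutive _

  gen-isReflection : ∀ g → IsReflection (gen g)
  gen-isReflection g = e , g , sym (begin
    (e · gen g) · inv e ≡⟨ cong ((e · gen g) ·_) inv-e ⟩
    (e · gen g) · e     ≡⟨ ·-identityʳ _ ⟩
    e · gen g           ≡⟨ ·-identityˡ _ ⟩
    gen g               ∎)
    where open ≡-Reasoning

  reflection-flips : ∀ {t} → IsReflection t → proj₂ t ≡ true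
  reflection-flips ((a , false) , gs , refl) = refl
  reflection-flips ((a , false) , gr , refl) = refl
  reflection-flips ((a , true)  , gs , refl) = refl
  reflection-flips ((a , true)  , gr , refl) = refl

module Cycle (h : ℕ) where

  m N : ℕ
  m = suc h
  N = m + m

  open Congruence N

  infixl 6 _⊖_
  _⊖_ : ℕ → ℕ → ℕ
  p ⊖ q = (p + (N ∸ q)) % N

  ⊖<N : ∀ p q → p ⊖ q < N
  ⊖<N p q = m%n<n (p + (N ∸ q)) N

  ⊖-+-≋ : ∀ p {q} → q ≤ N → p ⊖ q + q ≋ p
  ⊖-+-≋ p {q} q≤N = begin
    p ⊖ q + q            ≈⟨ +-cong (m%M≋m (p + (N ∸ q))) ≋-refl ⟩
    p + (N ∸ q) + q      ≡⟨ +-assoc p _ q ⟩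
    p + ((N ∸ q) + q)    ≡⟨ cong (p +_) (m∸n+n≡m q≤N) ⟩
    p + N                ≈⟨ +-cong ≋-refl M≋0 ⟩
    p + 0                ≡⟨ +-identityʳ p ⟩
    p                    ∎
    where open ≋-Reasoning

  ⊖-unique : ∀ {z p q} → z < N → q ≤ N → z + q ≋ p → z ≡ p ⊖ q
  ⊖-unique {z} {p} {q} z<N q≤N z+q≋p =
    ≋⇒≡ z<N (⊖<N p q) (+-cancelʳ-≋ q (≋-trans z+q≋p (≋-sym (⊖-+-≋ p q≤N))))

  m<N : m < N
  m<N = m<m+n m z<s

  ⊖-≤ : ∀ {p q} → q ≤ p → p < N → p ⊖ q ≡ p ∸ q
  ⊖-≤ {p} {q} q≤p p<N = sym (⊖-unique (≤-<-trans (m∸n≤m p q) p<N) (≤-trans q≤p (<⇒≤ p<N))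
                                       (≡⇒≋ (m∸n+n≡m q≤p)))

  ⊖-> : ∀ {p q} → p < q → q ≤ N → p ⊖ q ≡ p + (N ∸ q)
  ⊖-> {p} {q} p<q q≤N = m<n⇒m%n≡m (subst (p + (N ∸ q) <_) (m+[n∸m]≡n q≤N) (+-monoˡ-< (N ∸ q) p<q))

  N∸[p+[N∸q]] : ∀ p {q} → q ≤ N → N ∸ (p + (N ∸ q)) ≡ q ∸ p
  N∸[p+[N∸q]] p {q} q≤N = begin
    N ∸ (p + (N ∸ q))   ≡⟨ cong (N ∸_) (+-comm p _) ⟩
    N ∸ ((N ∸ q) + p)   ≡⟨ ∸-+-assoc N (N ∸ q) p ⟨
    N ∸ (N ∸ q) ∸ p     ≡⟨ cong (_∸ p) (m∸[m∸n]≡n q≤N) ⟩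
    q ∸ p               ∎
    where open ≡-Reasoning

  dist : ℕ → ℕ
  dist c = c ⊓ (N ∸ c)

  dist≤id : ∀ c → dist c ≤ c
  dist≤id c = m⊓n≤m c _

  dist≤N∸ : ∀ c → dist c ≤ N ∸ c
  dist≤N∸ c = m⊓n≤n c _

  dist-small : ∀ {c} → c ≤ m → dist c ≡ c
  dist-small {c} c≤m = m≤n⇒m⊓n≡m (m+n≤o⇒m≤o∸n c (+-mono-≤ c≤m c≤m))

  dist-large : ∀ {c} → m ≤ c → c ≤ N → dist c ≡ N ∸ c
  dist-large {c} m≤c c≤N = m≥n⇒m⊓n≡n (m≤n+o⇒m∸n≤o N c (+-mono-≤ m≤c m≤c))

  dist≤m : ∀ c → dist c ≤ m
  dist≤m c with c ≤? m
  ... | yes c≤m = ≤-trans (dist≤id c) c≤m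
  ... | no c≰m  = ≤-trans (dist≤N∸ c) (m≤n+o⇒m∸n≤o N c (+-monoˡ-≤ m (<⇒≤ (≰⇒> c≰m))))

  dist≡0 : ∀ {c} → c < N → dist c ≡ 0 → c ≡ 0
  dist≡0 {c} c<N p with ⊓-sel c (N ∸ c)
  ... | inj₁ q = trans (sym q) p
  ... | inj₂ q = ⊥-elim (<⇒≱ c<N (m∸n≡0⇒m≤n (trans (sym q) p)))

  neg : ℕ → ℕ
  neg a = 0 ⊖ a

  neg<N : ∀ a → neg a < N
  neg<N a = ⊖<N 0 a

  neg-zero : neg 0 ≡ 0
  neg-zero = sym (⊖-unique z<s z≤n ≋-refl)

  neg-pos : ∀ {a} → 0 < a → a ≤ N → neg a ≡ N ∸ a
  neg-pos = ⊖->

  neg-involutive : ∀ {a} → a < N → neg (neg a) ≡ a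
  neg-involutive {zero}  _   = trans (cong neg neg-zero) neg-zero
  neg-involutive {suc a} a<N = begin
    neg (neg (suc a))    ≡⟨ cong neg (neg-pos z<s (<⇒≤ a<N)) ⟩
    neg (N ∸ suc a)      ≡⟨ neg-pos (m<n⇒0<n∸m a<N) (m∸n≤m N (suc a)) ⟩
    N ∸ (N ∸ suc a)      ≡⟨ m∸[m∸n]≡n (<⇒≤ a<N) ⟩
    suc a                ∎
    where open ≡-Reasoning

  dist-neg : ∀ {a} → a < N → dist (neg a) ≡ dist a
  dist-neg {zero}  _   = cong dist neg-zero
  dist-neg {suc a} a<N = trans (cong dist (neg-pos z<s (<⇒≤ a<N)))
                               (trans (cong ((N ∸ suc a) ⊓_) (m∸[m∸n]≡n (<⇒≤ a<N))) (⊓-comm _ _))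

  neg-+-≋ : ∀ {a} → a < N → neg a + a ≋ 0
  neg-+-≋ a<N = ⊖-+-≋ 0 (<⇒≤ a<N)

  neg-⊖ : ∀ {a b} → a < N → b < N → neg a ⊖ neg b ≡ neg (a ⊖ b)
  neg-⊖ {a} {b} a<N b<N = sym (⊖-unique (neg<N (a ⊖ b)) (<⇒≤ (neg<N b)) (+-cancelʳ-≋ a (begin
    neg (a ⊖ b) + neg b + a                  ≈⟨ +-cong ≋-refl (⊖-+-≋ a (<⇒≤ b<N)) ⟨
    neg (a ⊖ b) + neg b + ((a ⊖ b) + b)      ≡⟨ interchange (neg (a ⊖ b)) (neg b) (a ⊖ b) b ⟩
    (neg (a ⊖ b) + (a ⊖ b)) + (neg b + b)    ≈⟨ +-cong (neg-+-≋ (⊖<N a b)) (neg-+-≋ b<N) ⟩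
    0                                        ≈⟨ neg-+-≋ a<N ⟨
    neg a + a                                ∎)))
    where
    open ≋-Reasoning
    interchange : ∀ w x y z → (w + x) + (y + z) ≡ (w + y) + (x + z)
    interchange = solve-∀

  dist-neg-⊖ : ∀ {a b} → a < N → b < N → dist (neg a ⊖ neg b) ≡ dist (a ⊖ b)
  dist-neg-⊖ {a} {b} a<N b<N = trans (cong dist (neg-⊖ a<N b<N)) (dist-neg (⊖<N a b))

  neg≡0 : ∀ {a} → a < N → neg a ≡ 0 → a ≡ 0
  neg≡0 a<N p = trans (sym (neg-involutive a<N)) (trans (cong neg p) neg-zero)

  -- x = 0, or x is strictly closer to c than 0 is; for c ≤ m this means x lies on the arc [0, 2c).
  InArc : ℕ → ℕ → Set
  InArc c x = x ≡ 0 ⊎ dist (x ⊖ c) < dist c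

  closer-to-c⇒0<y<2c : ∀ {c y} → c ≤ m → y < N → dist (y ⊖ c) < c → 0 < y × y < c + c
  closer-to-c⇒0<y<2c {c} {zero} c≤m _ closer =
    ⊥-elim (<⇒≱ closer (≤-reflexive (sym (trans (dist-neg (≤-<-trans c≤m m<N)) (dist-small c≤m)))))
  closer-to-c⇒0<y<2c {c} {suc y} _ y<N closer = z<s , ≰⇒> (λ 2c≤y → <⇒≱ closer (far 2c≤y))
    where
    far : c + c ≤ suc y → c ≤ dist (suc y ⊖ c)
    far 2c≤y = subst (λ z → c ≤ dist z) (sym (⊖-≤ c≤y y<N))
                     (⊓-glb (m+n≤o⇒m≤o∸n c 2c≤y)
                            (m+n≤o⇒m≤o∸n c (≤-trans (≤-reflexive (m+[n∸m]≡n c≤y)) (<⇒≤ y<N))))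
      where c≤y = ≤-trans (m≤m+n c c) 2c≤y

  0<y<2c⇒closer-to-c : ∀ {c y} → c ≤ m → y < N → 0 < y → y < c + c → dist (y ⊖ c) < c
  0<y<2c⇒closer-to-c {c} {y} c≤m y<N 0<y y<2c with c ≤? y
  ... | yes c≤y = subst (λ z → dist z < c) (sym (⊖-≤ c≤y y<N))
                        (≤-<-trans (dist≤id _) (subst (y ∸ c <_) (m+n∸n≡m c c) (∸-monoˡ-< y<2c c≤y)))
  ... | no c≰y  = subst (λ z → dist z < c) (sym (⊖-> y<c c≤N))
                        (≤-<-trans (dist≤N∸ _)
                                   (subst (_< c) (sym (N∸[p+[N∸q]] y c≤N)) (∸-monoʳ-< 0<y (<⇒≤ y<c))))
    where
    y<c = ≰⇒> c≰y
    c≤N = ≤-trans c≤m (<⇒≤ m<N)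

  -- If t ⊖ x wrapped past 2c, it would be at most as far from 0 as x.
  reflection-stays-in-arc : ∀ {c x t} → x < N → t < N → x ≤ c + c → t < c + c →
                            dist x < dist (t ⊖ x) → t ⊖ x < c + c
  reflection-stays-in-arc {c} {x} {t} x<N t<N x≤2c t<2c longer with x ≤? t
  ... | yes x≤t = subst (_< c + c) (sym (⊖-≤ x≤t t<N)) (≤-<-trans (m∸n≤m t x) t<2c)
  ... | no x≰t  = subst (_< c + c) (sym wrapped)
                        (≰⇒> λ 2c≤y → <⇒≱ (subst (λ z → dist x < dist z) wrapped longer) (not-longer 2c≤y))
    where
    wrapped = ⊖-> (≰⇒> x≰t) (<⇒≤ x<N)
    y = t + (N ∸ x)
    not-longer : c + c ≤ y → dist y ≤ dist x
    not-longer 2c≤y = ⊓-glb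
      (≤-trans (dist≤N∸ y) (≤-trans (≤-reflexive (N∸[p+[N∸q]] t (<⇒≤ x<N))) (m∸n≤m x t)))
      (≤-trans (dist≤N∸ y) (≤-trans (∸-monoʳ-≤ N 2c≤y) (∸-monoʳ-≤ N x≤2c)))

  InArc-reflect-small : ∀ {c x t} → c ≤ m → x < N → t < N → InArc c x →
                        dist (t ⊖ c) < dist c → dist x < dist (t ⊖ x) → InArc c (t ⊖ x)
  InArc-reflect-small {c} {x} {t} c≤m x<N t<N x∈arc t-closer longer with t ⊖ x ≟ 0
  ... | yes t⊖x≡0 = inj₁ t⊖x≡0
  ... | no t⊖x≢0  = inj₂ (subst (dist ((t ⊖ x) ⊖ c) <_) (sym dist-c)
                      (0<y<2c⇒closer-to-c c≤m (⊖<N t x) (n≢0⇒n>0 t⊖x≢0)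
                        (reflection-stays-in-arc {c} x<N t<N (<⇒≤ x<2c) t<2c longer)))
    where
    dist-c = dist-small c≤m
    t<2c = proj₂ (closer-to-c⇒0<y<2c c≤m t<N (subst (dist (t ⊖ c) <_) dist-c t-closer))
    below-2c : InArc c x → x < c + c
    below-2c (inj₁ refl)   = ≤-trans (≤-<-trans z≤n (subst (dist (t ⊖ c) <_) dist-c t-closer)) (m≤m+n c c)
    below-2c (inj₂ closer) = proj₂ (closer-to-c⇒0<y<2c c≤m x<N (subst (dist (x ⊖ c) <_) dist-c closer))
    x<2c = below-2c x∈arc

  -- Positions c beyond m are reduced to InArc-reflect-small by the symmetry neg of the cycle.
  InArc-reflect : ∀ {c x t} → c < N → x < N → t < N → InArc c x →
                  dist (t ⊖ c) < dist c → dist x < dist (t ⊖ x) → InArc c (t ⊖ x)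
  InArc-reflect {c} {x} {t} c<N x<N t<N x∈arc t-closer longer with c ≤? m
  ... | yes c≤m = InArc-reflect-small c≤m x<N t<N x∈arc t-closer longer
  ... | no c≰m  = from-neg (InArc-reflect-small negc≤m (neg<N x) (neg<N t) (to-neg x∈arc)
                    (subst₂ _<_ (sym (dist-neg-⊖ t<N c<N)) (sym dist-negc) t-closer)
                    (subst₂ _<_ (sym (dist-neg x<N)) (sym (dist-neg-⊖ t<N x<N)) longer))
    where
    dist-negc = dist-neg c<N
    negc≤m : neg c ≤ m
    negc≤m = subst (_≤ m) (sym (neg-pos (≤-<-trans z≤n (≰⇒> c≰m)) (<⇒≤ c<N)))
                   (m≤n+o⇒m∸n≤o N c (+-monoˡ-≤ m (<⇒≤ (≰⇒> c≰m))))
    to-neg : InArc c x → InArc (neg c) (neg x)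
    to-neg (inj₁ refl)   = inj₁ neg-zero
    to-neg (inj₂ closer) = inj₂ (subst₂ _<_ (sym (dist-neg-⊖ x<N c<N)) (sym dist-negc) closer)
    from-neg : InArc (neg c) (neg t ⊖ neg x) → InArc c (t ⊖ x)
    from-neg (inj₁ p)      = inj₁ (neg≡0 (⊖<N t x) (trans (sym (neg-⊖ t<N x<N)) p))
    from-neg (inj₂ closer) = inj₂ (subst₂ _<_ (trans (cong (λ z → dist (z ⊖ neg c)) (neg-⊖ t<N x<N))
                                                      (dist-neg-⊖ (⊖<N t x) c<N)) dist-negc closer)

  dist-1⊖ : ∀ {x} → x < N → dist (1 ⊖ x) ≤ suc (dist x)
  dist-1⊖ {x} x<N with x ≤? 1
  ... | yes x≤1 = subst (λ z → dist z ≤ suc (dist x)) (sym (⊖-≤ x≤1 (≤-<-trans (s≤s z≤n) m<N)))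
                        (≤-trans (dist≤id _) (≤-trans (m∸n≤m 1 x) (s≤s z≤n)))
  ... | no x≰1  = subst (λ z → dist z ≤ suc (dist x)) (sym (⊖-> (≰⇒> x≰1) (<⇒≤ x<N))) bound
    where
    y = 1 + (N ∸ x)
    bound : dist y ≤ suc (dist x)
    bound with ⊓-sel x (N ∸ x)
    ... | inj₁ p = ≤-trans (dist≤N∸ y) (≤-trans (≤-reflexive (N∸[p+[N∸q]] 1 (<⇒≤ x<N)))
                                          (≤-trans (m∸n≤m x 1) (≤-trans (≤-reflexive (sym p)) (n≤1+n _))))
    ... | inj₂ p = ≤-trans (dist≤id y) (≤-reflexive (cong suc (sym p)))

  dist-[N∸1]⊖ : ∀ {x} → x < N → dist ((N ∸ 1) ⊖ x) ≤ suc (dist x)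
  dist-[N∸1]⊖ {x} x<N = begin
    dist ((N ∸ 1) ⊖ x)         ≡⟨ cong (λ z → dist (z ⊖ x)) (neg-pos z<s (<⇒≤ 1<N)) ⟨
    dist (neg 1 ⊖ x)           ≡⟨ cong (λ z → dist (neg 1 ⊖ z)) (neg-involutive x<N) ⟨
    dist (neg 1 ⊖ neg (neg x)) ≡⟨ dist-neg-⊖ 1<N (neg<N x) ⟩
    dist (1 ⊖ neg x)           ≤⟨ dist-1⊖ (neg<N x) ⟩
    suc (dist (neg x))         ≡⟨ cong suc (dist-neg x<N) ⟩
    suc (dist x)               ∎
    where
    open ≤-Reasoning
    1<N = ≤-<-trans (s≤s z≤n) m<N

  1⊖neg : ∀ {n} → suc n < N → 1 ⊖ neg n ≡ suc n
  1⊖neg {n} n<N = sym (⊖-unique n<N (<⇒≤ (neg<N n)) (begin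
    suc n + neg n      ≡⟨ cong suc (+-comm n (neg n)) ⟩
    1 + (neg n + n)    ≈⟨ +-cong ≋-refl (neg-+-≋ (<-trans (n<1+n n) n<N)) ⟩
    1                  ∎))
    where open ≋-Reasoning

  [N∸1]⊖ : ∀ {n} → suc n < N → (N ∸ 1) ⊖ n ≡ neg (suc n)
  [N∸1]⊖ {n} n<N = sym (⊖-unique (neg<N (suc n)) (<⇒≤ (<-trans (n<1+n n) n<N)) (+-cancelʳ-≋ 1 (begin
    neg (suc n) + n + 1      ≡⟨ trans (+-assoc (neg (suc n)) n 1) (cong (neg (suc n) +_) (+-comm n 1)) ⟩
    neg (suc n) + suc n      ≈⟨ neg-+-≋ n<N ⟩
    0                        ≈⟨ M≋0 ⟨
    N                        ≡⟨ m∸n+n≡m (≤-trans (s≤s z≤n) (<⇒≤ n<N)) ⟨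
    N ∸ 1 + 1                ∎)))
    where open ≋-Reasoning

module CoxeterLength (k : ℕ) where

  open Cycle (suc k) public
  open Dihedral m public
  open DihedralGroup m public
  open Congruence N
  private module Mod-m = Congruence m

  pred-double : ℕ → ℕ
  pred-double zero    = N ∸ 1
  pred-double (suc a) = suc (a + a)

  pos : D → ℕ
  pos (a , false) = toℕ a + toℕ a
  pos (a , true)  = pred-double (toℕ a)

  pred-double<N : ∀ a → a < m → pred-double a < N
  pred-double<N zero    _   = n<1+n (N ∸ 1)
  pred-double<N (suc a) a<m = ≤-trans (s≤s (≤-reflexive (sym (+-suc a a)))) (+-mono-≤ (<⇒≤ a<m) (<⇒≤ a<m))

  pos<N : ∀ x → pos x < N
  pos<N (a , false) = +-mono-< (toℕ<n a) (toℕ<n a)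
  pos<N (a , true)  = pred-double<N (toℕ a) (toℕ<n a)

  N∸1 : N ∸ 1 ≡ suc (suc k + suc k)
  N∸1 = cong suc (+-suc k (suc k))

  offset : Bool → ℕ
  offset false = 0
  offset true  = N ∸ 1

  pos-≋ : ∀ a ε → pos (a , ε) ≋ (toℕ a + toℕ a) + offset ε
  pos-≋ a false = ≡⇒≋ (sym (+-identityʳ _))
  pos-≋ a true with toℕ a
  ... | zero  = ≋-refl
  ... | suc j = ≋-sym (≋-trans (≡⇒≋ (trans (cong ((suc j + suc j) +_) N∸1) (wrap j k))) (m+kM≋m _ 1))
    where
    wrap : ∀ j k → (suc j + suc j) + suc (suc k + suc k) ≡ suc (j + j) + 1 * (suc (suc k) + suc (suc k))
    wrap = solve-∀

  double-cong : ∀ {x y} → x Mod-m.≋ y → x + x ≋ y + y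
  double-cong {x} {y} (Mod-m.mkCong x%m≡y%m) = begin
    x + x                 ≈⟨ reduce x ⟩
    x % m + x % m         ≡⟨ cong (λ z → z + z) x%m≡y%m ⟩
    y % m + y % m         ≈⟨ reduce y ⟨
    y + y                 ∎
    where
    open ≋-Reasoning
    regroup : ∀ r q M → (r + q * M) + (r + q * M) ≡ (r + r) + q * (M + M)
    regroup = solve-∀
    reduce : ∀ z → z + z ≋ z % m + z % m
    reduce z = ≋-trans (≡⇒≋ (trans (cong (λ w → w + w) (m≡m%n+[m/n]*n z m)) (regroup (z % m) (z / m) m)))
                       (m+kM≋m _ (z / m))

  offset-not : ∀ δ → offset (not δ) + offset δ ≡ N ∸ 1
  offset-not false = +-identityʳ _
  offset-not true  = refl

  pos-ρᵃs-· : ∀ a y → pos ((a , true) · y) ≡ pos (a , true) ⊖ pos y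
  pos-ρᵃs-· a (b , δ) = ⊖-unique (pos<N (addZ a (negZ b) , not δ)) (<⇒≤ (pos<N (b , δ))) (begin
    pos (c , not δ) + pos (b , δ)
      ≈⟨ +-cong (pos-≋ c (not δ)) (pos-≋ b δ) ⟩
    ((toℕ c + toℕ c) + offset (not δ)) + ((toℕ b + toℕ b) + offset δ)
      ≈⟨ +-cong (+-cong (double-cong (toℕ-addZ a (negZ b))) ≋-refl) ≋-refl ⟩
    (((toℕ a + toℕ (negZ b)) + (toℕ a + toℕ (negZ b))) + offset (not δ)) + ((toℕ b + toℕ b) + offset δ)
      ≡⟨ regroup (toℕ a) (toℕ (negZ b)) (toℕ b) (offset (not δ)) (offset δ) ⟩
    ((toℕ a + toℕ a) + ((toℕ (negZ b) + toℕ b) + (toℕ (negZ b) + toℕ b))) + (offset (not δ) + offset δ)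
      ≈⟨ +-cong (+-cong ≋-refl (double-cong (toℕ-negZ b))) (≡⇒≋ (offset-not δ)) ⟩
    ((toℕ a + toℕ a) + 0) + (N ∸ 1)
      ≡⟨ cong (_+ (N ∸ 1)) (+-identityʳ _) ⟩
    (toℕ a + toℕ a) + offset true
      ≈⟨ pos-≋ a true ⟨
    pos (a , true) ∎)
    where
    open ≋-Reasoning
    c = addZ a (negZ b)
    regroup : ∀ x y z u v → (((x + y) + (x + y)) + u) + ((z + z) + v) ≡ ((x + x) + ((y + z) + (y + z))) + (u + v)
    regroup = solve-∀

  double-injective : ∀ x y → x + x ≡ y + y → x ≡ y
  double-injective x y p = trans (n≡⌊n+n/2⌋ x) (trans (cong ⌊_/2⌋ p) (sym (n≡⌊n+n/2⌋ y)))

  double≢odd : ∀ x y → x + x ≢ suc (y + y)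
  double≢odd x y p = 1+n≢n (begin
    suc y                  ≡⟨ cong suc (n≡⌊n+n/2⌋ y) ⟩
    ⌈ suc (y + y) /2⌉      ≡⟨ cong ⌈_/2⌉ p ⟨
    ⌈ x + x /2⌉            ≡⟨ n≡⌈n+n/2⌉ x ⟨
    x                      ≡⟨ n≡⌊n+n/2⌋ x ⟩
    ⌊ x + x /2⌋            ≡⟨ cong ⌊_/2⌋ p ⟩
    ⌊ suc (y + y) /2⌋      ≡⟨ n≡⌈n+n/2⌉ y ⟨
    y                      ∎)
    where open ≡-Reasoning

  pred-double-odd : ∀ a → Σ ℕ λ j → pred-double a ≡ suc (j + j)
  pred-double-odd zero    = suc k , N∸1
  pred-double-odd (suc a) = a , refl

  pred-double-injective : ∀ {a b} → a < m → b < m → pred-double a ≡ pred-double b → a ≡ b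
  pred-double-injective {zero}  {zero}  _   _   _ = refl
  pred-double-injective {zero}  {suc b} _   b<m p =
    ⊥-elim (<-irrefl (sym (double-injective (suc k) b (suc-injective (trans (sym N∸1) p)))) (≤-pred b<m))
  pred-double-injective {suc a} {zero}  a<m _   p =
    ⊥-elim (<-irrefl (sym (double-injective (suc k) a (suc-injective (trans (sym N∸1) (sym p))))) (≤-pred a<m))
  pred-double-injective {suc a} {suc b} _   _   p = cong suc (double-injective a b (suc-injective p))

  pos-injective : ∀ x y → pos x ≡ pos y → x ≡ y
  pos-injective (a , false) (b , false) p = cong (_, false) (toℕ-injective (double-injective _ _ p))
  pos-injective (a , true)  (b , true)  p = cong (_, true) (toℕ-injective (pred-double-injective (toℕ<n a) (toℕ<n b) p))
  pos-injective (a , false) (b , true)  p with pred-double-odd (toℕ b)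
  ... | j , odd = ⊥-elim (double≢odd (toℕ a) j (trans p odd))
  pos-injective (a , true)  (b , false) p with pred-double-odd (toℕ a)
  ... | j , odd = ⊥-elim (double≢odd (toℕ b) j (trans (sym p) odd))

  -- Shown to be the Coxeter length by Len-ℓ below.
  ℓ : D → ℕ
  ℓ w = dist (pos w)

  pos-gen-· : ∀ g x → pos (gen g · x) ≡ pos (gen g) ⊖ pos x
  pos-gen-· gs = pos-ρᵃs-· (modm 0)
  pos-gen-· gr = pos-ρᵃs-· (modm 1)

  ℓ-gen-· : ∀ g x → ℓ (gen g · x) ≤ suc (ℓ x)
  ℓ-gen-· gs x = subst (λ z → dist z ≤ suc (ℓ x)) (sym (pos-gen-· gs x)) (dist-[N∸1]⊖ (pos<N x))
  ℓ-gen-· gr x = subst (λ z → dist z ≤ suc (ℓ x)) (sym (pos-gen-· gr x)) (dist-1⊖ (pos<N x))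

  ℓ-eval≤length : ∀ ws → ℓ (eval ws) ≤ length ws
  ℓ-eval≤length []       = z≤n
  ℓ-eval≤length (g ∷ ws) = ≤-trans (ℓ-gen-· g (eval ws)) (s≤s (ℓ-eval≤length ws))

  flip : Gen → Gen
  flip gs = gr
  flip gr = gs

  alt : Gen → ℕ → Word
  alt g zero    = []
  alt g (suc n) = g ∷ alt (flip g) n

  length-alt : ∀ g n → length (alt g n) ≡ n
  length-alt g zero    = refl
  length-alt g (suc n) = cong suc (length-alt (flip g) n)

  pos-alt : ∀ n → n ≤ m → pos (eval (alt gr n)) ≡ n × pos (eval (alt gs n)) ≡ neg n
  pos-alt zero    _   = refl , sym neg-zero
  pos-alt (suc n) n<m =
    trans (pos-gen-· gr (eval (alt gs n))) (trans (cong (1 ⊖_) (proj₂ ih)) (1⊖neg n<N)) ,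
    trans (pos-gen-· gs (eval (alt gr n))) (trans (cong ((N ∸ 1) ⊖_) (proj₁ ih)) ([N∸1]⊖ n<N))
    where
    ih = pos-alt n (≤-trans (n≤1+n n) n<m)
    n<N = ≤-<-trans n<m m<N

  ℓ-alt : ∀ g n → n ≤ m → ℓ (eval (alt g n)) ≡ n
  ℓ-alt gr n n≤m = trans (cong dist (proj₁ (pos-alt n n≤m))) (dist-small n≤m)
  ℓ-alt gs n n≤m = trans (cong dist (proj₂ (pos-alt n n≤m)))
                         (trans (dist-neg (≤-<-trans n≤m m<N)) (dist-small n≤m))

  -- Going around the 2m-gon the short way: rightwards from 0 through r, or leftwards through s.
  alt-reaches : ∀ x → Σ Gen λ g → eval (alt g (ℓ x)) ≡ x
  alt-reaches x with pos x ≤? m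
  ... | yes pos≤m = gr , pos-injective _ x (begin
    pos (eval (alt gr (ℓ x)))     ≡⟨ cong (λ n → pos (eval (alt gr n))) (dist-small pos≤m) ⟩
    pos (eval (alt gr (pos x)))   ≡⟨ proj₁ (pos-alt (pos x) pos≤m) ⟩
    pos x                         ∎)
    where open ≡-Reasoning
  ... | no pos≰m = gs , pos-injective _ x (begin
    pos (eval (alt gs (ℓ x)))           ≡⟨ cong (λ n → pos (eval (alt gs n))) (dist-large m≤pos pos≤N) ⟩
    pos (eval (alt gs (N ∸ pos x)))     ≡⟨ proj₂ (pos-alt (N ∸ pos x) N∸pos≤m) ⟩
    neg (N ∸ pos x)                     ≡⟨ neg-pos (m<n⇒0<n∸m (pos<N x)) (m∸n≤m N (pos x)) ⟩
    N ∸ (N ∸ pos x)                     ≡⟨ m∸[m∸n]≡n pos≤N ⟩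
    pos x                               ∎)
    where
    open ≡-Reasoning
    m≤pos = <⇒≤ (≰⇒> pos≰m)
    pos≤N = <⇒≤ (pos<N x)
    N∸pos≤m = m≤n+o⇒m∸n≤o N (pos x) (+-monoˡ-≤ m m≤pos)

  shortest-word : D → Word
  shortest-word x = alt (proj₁ (alt-reaches x)) (ℓ x)

  eval-shortest-word : ∀ x → eval (shortest-word x) ≡ x
  eval-shortest-word x = proj₂ (alt-reaches x)

  length-shortest-word : ∀ x → length (shortest-word x) ≡ ℓ x
  length-shortest-word x = length-alt _ (ℓ x)

  Len-ℓ : ∀ x → Len x (ℓ x)
  Len-ℓ x = (shortest-word x , eval-shortest-word x , length-shortest-word x)
          , λ ws eval≡x → subst (λ z → ℓ z ≤ length ws) eval≡x (ℓ-eval≤length ws)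

  Len⇒≡ℓ : ∀ {x n} → Len x n → n ≡ ℓ x
  Len⇒≡ℓ {x} ((ws , eval≡x , length≡n) , minimal) = ≤-antisym
    (subst (_ ≤_) (length-shortest-word x) (minimal (shortest-word x) (eval-shortest-word x)))
    (subst₂ (λ z l → ℓ z ≤ l) eval≡x length≡n (ℓ-eval≤length ws))

  LenLt⇒< : ∀ {x y} → LenLt x y → ℓ x < ℓ y
  LenLt⇒< (_ , _ , Len-x , Len-y , a<b) = subst₂ _<_ (Len⇒≡ℓ Len-x) (Len⇒≡ℓ Len-y) a<b

  <⇒LenLt : ∀ {x y} → ℓ x < ℓ y → LenLt x y
  <⇒LenLt {x} {y} ℓx<ℓy = ℓ x , ℓ y , Len-ℓ x , Len-ℓ y , ℓx<ℓy

  eval-++ : ∀ as bs → eval (as ++ bs) ≡ eval as · eval bs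
  eval-++ []       bs = sym (·-identityˡ _)
  eval-++ (g ∷ as) bs = trans (cong (gen g ·_) (eval-++ as bs)) (sym (·-assoc (gen g) (eval as) (eval bs)))

  ℓ-·-≤ : ∀ x y → ℓ (x · y) ≤ ℓ x + ℓ y
  ℓ-·-≤ x y = subst₂ (λ z l → ℓ z ≤ l) eval≡ length≡ (ℓ-eval≤length (shortest-word x ++ shortest-word y))
    where
    eval≡ : eval (shortest-word x ++ shortest-word y) ≡ x · y
    eval≡ = trans (eval-++ (shortest-word x) _) (cong₂ _·_ (eval-shortest-word x) (eval-shortest-word y))
    length≡ : length (shortest-word x ++ shortest-word y) ≡ ℓ x + ℓ y
    length≡ = trans (length-++ (shortest-word x)) (cong₂ _+_ (length-shortest-word x) (length-shortest-word y))

module WeakOrder (k : ℕ) where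

  open CoxeterLength k

  ≤R-factor : ∀ {x y} → x ≤R y → Σ Word λ bs → y ≡ x · eval bs × ℓ y ≡ ℓ x + length bs
  ≤R-factor {x} {y} (as , bs , (eval-as , Len-as) , (eval-as++bs , Len-as++bs)) = bs , y≡x·b , ℓy≡
    where
    open ≡-Reasoning
    y≡x·b = begin
      y                     ≡⟨ eval-as++bs ⟨
      eval (as ++ bs)       ≡⟨ eval-++ as bs ⟩
      eval as · eval bs     ≡⟨ cong (_· eval bs) eval-as ⟩
      x · eval bs           ∎
    ℓy≡ = begin
      ℓ y                     ≡⟨ Len⇒≡ℓ Len-as++bs ⟨
      length (as ++ bs)       ≡⟨ length-++ as ⟩
      length as + length bs   ≡⟨ cong (_+ length bs) (Len⇒≡ℓ Len-as) ⟩
      ℓ x + length bs         ∎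

  TL-mono : ∀ {x y t} → x ≤R y → TL x t → TL y t
  TL-mono {x} {y} {t} x≤y (t∈T , shorter) with ≤R-factor x≤y
  ... | bs , y≡x·b , ℓy≡ = t∈T , <⇒LenLt (begin-strict
    ℓ (t · y)               ≡⟨ cong (λ z → ℓ (t · z)) y≡x·b ⟩
    ℓ (t · (x · b))         ≡⟨ cong ℓ (·-assoc t x b) ⟨
    ℓ ((t · x) · b)         ≤⟨ ℓ-·-≤ (t · x) b ⟩
    ℓ (t · x) + ℓ b         <⟨ +-mono-<-≤ (LenLt⇒< shorter) (ℓ-eval≤length bs) ⟩
    ℓ x + length bs         ≡⟨ ℓy≡ ⟨
    ℓ y                     ∎)
    where
    open ≤-Reasoning
    b = eval bs

  Reduced-shortest-word : ∀ x → Reduced (shortest-word x) x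
  Reduced-shortest-word x = eval-shortest-word x , subst (Len x) (sym (length-shortest-word x)) (Len-ℓ x)

  ≤R-refl : ∀ x → x ≤R x
  ≤R-refl x = shortest-word x , [] , Reduced-shortest-word x
            , subst (λ ws → Reduced ws x) (sym (++-identityʳ _)) (Reduced-shortest-word x)

  e≤R : ∀ v → e ≤R v
  e≤R v = [] , shortest-word v , (refl , Len-ℓ e) , Reduced-shortest-word v

  flipⁿ : ℕ → Gen → Gen
  flipⁿ zero    g = g
  flipⁿ (suc a) g = flipⁿ a (flip g)

  alt-+ : ∀ g a d → alt g (a + d) ≡ alt g a ++ alt (flipⁿ a g) d
  alt-+ g zero    d = refl
  alt-+ g (suc a) d = cong (g ∷_) (alt-+ (flip g) a d)

  Reduced-alt : ∀ g n → n ≤ m → Reduced (alt g n) (eval (alt g n))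
  Reduced-alt g n n≤m = refl , subst (Len (eval (alt g n))) (trans (ℓ-alt g n n≤m) (sym (length-alt g n))) (Len-ℓ _)

  alt-≤R : ∀ g {a b} → a ≤ b → b ≤ m → eval (alt g a) ≤R eval (alt g b)
  alt-≤R g {a} {b} a≤b b≤m = alt g a , alt (flipⁿ a g) (b ∸ a) , Reduced-alt g a (≤-trans a≤b b≤m)
    , subst (λ ws → Reduced ws (eval (alt g b))) (trans (cong (alt g) (sym (m+[n∸m]≡n a≤b))) (alt-+ g a (b ∸ a)))
            (Reduced-alt g b b≤m)

  TL-alt : ∀ g n → suc n ≤ m → TL (eval (alt g (suc n))) (gen g)
  TL-alt g n n<m = gen-isReflection g , <⇒LenLt (begin-strict
    ℓ (gen g · (gen g · x))    ≡⟨ cong ℓ (·-assoc (gen g) (gen g) x) ⟨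
    ℓ ((gen g · gen g) · x)    ≡⟨ cong (λ z → ℓ (z · x)) (gen-involutive g) ⟩
    ℓ (e · x)                  ≡⟨ cong ℓ (·-identityˡ x) ⟩
    ℓ x                        ≡⟨ ℓ-alt (flip g) n (≤-trans (n≤1+n n) n<m) ⟩
    n                          <⟨ n<1+n n ⟩
    suc n                      ≡⟨ ℓ-alt g (suc n) n<m ⟨
    ℓ (eval (alt g (suc n)))   ∎)
    where
    open ≤-Reasoning
    x = eval (alt (flip g) n)

  data WeakOrderCase (u v : D) : Set where
    below       : u ≤R v → WeakOrderCase u v
    above       : v ≤R u → WeakOrderCase u v
    descents-S  : (∀ g → TL u (gen g) ⊎ TL v (gen g)) → WeakOrderCase u v

  alt-comparable : ∀ g {a b} → a ≤ m → b ≤ m → WeakOrderCase (eval (alt g a)) (eval (alt g b))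
  alt-comparable g {a} {b} a≤m b≤m with a ≤? b
  ... | yes a≤b = below (alt-≤R g a≤b b≤m)
  ... | no  a≰b = above (alt-≤R g (<⇒≤ (≰⇒> a≰b)) a≤m)

  weakOrderCase-alt : ∀ g g′ a b → a ≤ m → b ≤ m → WeakOrderCase (eval (alt g a)) (eval (alt g′ b))
  weakOrderCase-alt g  g′ zero    b       _   _   = below (e≤R _)
  weakOrderCase-alt g  g′ (suc a) zero    _   _   = above (e≤R _)
  weakOrderCase-alt gs gr (suc a) (suc b) a<m b<m =
    descents-S λ { gs → inj₁ (TL-alt gs a a<m) ; gr → inj₂ (TL-alt gr b b<m) }
  weakOrderCase-alt gr gs (suc a) (suc b) a<m b<m =
    descents-S λ { gr → inj₁ (TL-alt gr a a<m) ; gs → inj₂ (TL-alt gs b b<m) }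
  weakOrderCase-alt gs gs a       b       a≤m b≤m = alt-comparable gs a≤m b≤m
  weakOrderCase-alt gr gr a       b       a≤m b≤m = alt-comparable gr a≤m b≤m

  weakOrderCase : ∀ u v → WeakOrderCase u v
  weakOrderCase u v = subst₂ WeakOrderCase (eval-shortest-word u) (eval-shortest-word v)
                             (weakOrderCase-alt _ _ (ℓ u) (ℓ v) (dist≤m _) (dist≤m _))

module BruhatPaths (k : ℕ) where

  open CoxeterLength k
  open WeakOrder k

  pos-reflection-· : ∀ {t} x → IsReflection t → pos (t · x) ≡ pos t ⊖ pos x
  pos-reflection-· {a , _} x t∈T with reflection-flips t∈T
  ... | refl = pos-ρᵃs-· a x

  reflection≢e : ∀ {t} → IsReflection t → t ≢ e
  reflection≢e t∈T t≡e with trans (sym (reflection-flips t∈T)) (cong proj₂ t≡e)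
  ... | ()

  ℓ-reflection>0 : ∀ {t} → IsReflection t → 0 < ℓ t
  ℓ-reflection>0 {t} t∈T = n≢0⇒n>0 (λ ℓt≡0 → reflection≢e t∈T (pos-injective t e (dist≡0 (pos<N t) ℓt≡0)))

  V-reflection : ∀ {u v t} → IsReflection t → TL u t ⊎ TL v t → V u v t
  V-reflection {t = t} t∈T label = subst (V _ _) (·-identityʳ t)
    (step start t∈T label (<⇒LenLt (subst (λ z → 0 < ℓ z) (sym (·-identityʳ t)) (ℓ-reflection>0 t∈T))))

  module _ {u v : D} (descents : ∀ g → TL u (gen g) ⊎ TL v (gen g)) where

    V-alt : ∀ g n → n ≤ m → V u v (eval (alt g n))
    V-alt g zero    _   = start
    V-alt g (suc n) n<m = step (V-alt (flip g) n n≤m) (gen-isReflection g) (descents g)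
      (<⇒LenLt (subst₂ _<_ (sym (ℓ-alt (flip g) n n≤m)) (sym (ℓ-alt g (suc n) n<m)) (n<1+n n)))
      where n≤m = ≤-trans (n≤1+n n) n<m

    V-all : ∀ x → V u v x
    V-all x = subst (V u v) (eval-shortest-word x) (V-alt _ (ℓ x) (dist≤m _))

  TL-join⇒V : ∀ {u v j t} → IsJoin u v j → TL j t → V u v t
  TL-join⇒V {u} {v} (_ , _ , least) t∈TLj with weakOrderCase u v
  ... | below u≤v     = V-reflection (proj₁ t∈TLj) (inj₂ (TL-mono (least v u≤v (≤R-refl v)) t∈TLj))
  ... | above v≤u     = V-reflection (proj₁ t∈TLj) (inj₁ (TL-mono (least u (≤R-refl u) v≤u) t∈TLj))
  ... | descents-S ds = V-all ds _

  TL-labels⇒TL-join : ∀ {u v j t} → IsJoin u v j → TL u t ⊎ TL v t → TL j t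
  TL-labels⇒TL-join (u≤j , _ , _) (inj₁ t∈TLu) = TL-mono u≤j t∈TLu
  TL-labels⇒TL-join (_ , v≤j , _) (inj₂ t∈TLv) = TL-mono v≤j t∈TLv

  V⇒InArc : ∀ {u v j} → (∀ {t} → TL u t ⊎ TL v t → TL j t) → ∀ {x} → V u v x → InArc (pos j) (pos x)
  V⇒InArc _ start = inj₁ refl
  V⇒InArc {j = j} labels (step {x} {t} x∈V t∈T label longer) =
    subst (InArc (pos j)) (sym (pos-reflection-· x t∈T))
      (InArc-reflect (pos<N j) (pos<N x) (pos<N t) (V⇒InArc labels x∈V) t-closer x-closer)
    where
    t-closer : dist (pos t ⊖ pos j) < dist (pos j)
    t-closer = subst (_< ℓ j) (cong dist (pos-reflection-· j t∈T)) (LenLt⇒< (proj₂ (labels label)))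
    x-closer : dist (pos x) < dist (pos t ⊖ pos x)
    x-closer = subst (ℓ x <_) (cong dist (pos-reflection-· x t∈T)) (LenLt⇒< longer)

  InArc⇒TL : ∀ {j t} → IsReflection t → InArc (pos j) (pos t) → TL j t
  InArc⇒TL {j} {t} t∈T (inj₁ pos-t≡0) = ⊥-elim (reflection≢e t∈T (pos-injective t e pos-t≡0))
  InArc⇒TL {j} {t} t∈T (inj₂ closer)  =
    t∈T , <⇒LenLt (subst (_< ℓ j) (sym (cong dist (pos-reflection-· j t∈T))) closer)

  V∩T⇒TL-join : ∀ {u v j t} → IsJoin u v j → IsReflection t → V u v t → TL j t
  V∩T⇒TL-join join t∈T t∈V = InArc⇒TL t∈T (V⇒InArc (TL-labels⇒TL-join join) t∈V)

mainTheorem2 : (m : ℕ) .{{_ : NonZero m}} → 2 ≤ m → let open Dihedral m in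
    (u v j : D) → IsJoin u v j →
    (t : D) → (TL j t → IsReflection t × V u v t) × (IsReflection t × V u v t → TL j t)
mainTheorem2 (suc (suc k)) (s≤s (s≤s _)) u v j join t =
    (λ t∈TLj → proj₁ t∈TLj , TL-join⇒V join t∈TLj)
  , (λ { (t∈T , t∈V) → V∩T⇒TL-join join t∈T t∈V })
  where open BruhatPaths k
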